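{- For all integers $n,m\geq 1$, the graph $G_{n,m}$ is irreducible and triangle-free.
   Context: For integers $n,m\geq 1$, the graph $G_{n,m}$ has vertex set $\{v_0,v_1,\ldots,v_{8m}\}\cup\{u_{i,j}: 1\le i\le n+5m,\ 1\le j\le 8m\}\cup\{w_{i,j}: 1\le i\le n+5m,\ 1\le j\le 8m\}$ (all distinct), and its edges are exactly: $v_0v_j$ for all $1\le j\le 8m$; $v_ju_{i,j}$ and $v_jw_{i,j}$ for all $1\le i\le n+5m$, $1\le j\le 8m$; and $u_{i,j}w_{i,j'}$ for all $1\le i\le n+5m$ and all $1\le j,j'\le 8m$ with $j\neq j'$. For a vertex $u$, $N(u)$ is its set of neighbors. The diamond is the graph on $4$ vertices with $5$ edges ($K_4$ minus one edge). A graph is called irreducible if it contains no $K_4$ as an induced subgraph, contains no induced diamond, and has no two distinct vertices $u,v$ with $N(u)\subseteq N(v)$. -}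

module Defs where

open import Data.Nat using (ℕ; zero; suc; _+_; _*_)
open import Data.Fin using (Fin; zero; suc)
open import Data.Sum using (_⊎_)
open import Data.Product using (_×_)
open import Relation.Nullary using (¬_)
open import Relation.Binary.PropositionalEquality using (_≡_; _≢_)

-- Generic graph notions, for a graph given by a vertex type V and an
-- adjacency relation Adj (assumed symmetric and loopless, as for G n m).

NbhdSubset : {V : Set} → (V → V → Set) → V → V → Set
NbhdSubset Adj a b = ∀ x → Adj a x → Adj b x

HasInducedK4 : {V : Set} → (V → V → Set) → Set
HasInducedK4 {V} Adj =
  ∃4 λ a b c d →
    (a ≢ b) × (a ≢ c) × (a ≢ d) × (b ≢ c) × (b ≢ d) × (c ≢ d) ×
    Adj a b × Adj a c × Adj a d × Adj b c × Adj b d × Adj c d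
  where
  open import Data.Product using (Σ)
  ∃4 : (V → V → V → V → Set) → Set
  ∃4 P = Σ V λ a → Σ V λ b → Σ V λ c → Σ V λ d → P a b c d

HasInducedDiamond : {V : Set} → (V → V → Set) → Set
HasInducedDiamond {V} Adj =
  ∃4 λ a b c d →
    (a ≢ b) × (a ≢ c) × (a ≢ d) × (b ≢ c) × (b ≢ d) × (c ≢ d) ×
    Adj a b × Adj a c × Adj a d × Adj b c × Adj b d × ¬ Adj c d
  where
  open import Data.Product using (Σ)
  ∃4 : (V → V → V → V → Set) → Set
  ∃4 P = Σ V λ a → Σ V λ b → Σ V λ c → Σ V λ d → P a b c d

HasTriangle : {V : Set} → (V → V → Set) → Set
HasTriangle {V} Adj =
  Σ V λ a → Σ V λ b → Σ V λ c →
    (a ≢ b) × (a ≢ c) × (b ≢ c) × Adj a b × Adj a c × Adj b c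
  where open import Data.Product using (Σ)

Irreducible : {V : Set} → (V → V → Set) → Set
Irreducible {V} Adj =
  ¬ HasInducedK4 Adj ×
  ¬ HasInducedDiamond Adj ×
  (∀ (a b : V) → a ≢ b → ¬ NbhdSubset Adj a b)

TriangleFree : {V : Set} → (V → V → Set) → Set
TriangleFree Adj = ¬ HasTriangle Adj

-- The graph G n m.
-- Indices are 0-based Fin values:  vtx k  is v_k  (0 ≤ k ≤ 8m),
-- uu i j is u_{i+1,j+1} and ww i j is w_{i+1,j+1}
-- (i : Fin (n + 5m), j : Fin (8m)).

data GV (n m : ℕ) : Set where
  vtx : Fin (suc (8 * m)) → GV n m
  uu  : Fin (n + 5 * m) → Fin (8 * m) → GV n m
  ww  : Fin (n + 5 * m) → Fin (8 * m) → GV n m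

-- the edges, each listed in one orientation
data GEdge (n m : ℕ) : GV n m → GV n m → Set where
  e-v0  : (j : Fin (8 * m)) → GEdge n m (vtx zero) (vtx (suc j))
  e-vu  : (i : Fin (n + 5 * m)) (j : Fin (8 * m)) → GEdge n m (vtx (suc j)) (uu i j)
  e-vw  : (i : Fin (n + 5 * m)) (j : Fin (8 * m)) → GEdge n m (vtx (suc j)) (ww i j)
  e-uw  : (i : Fin (n + 5 * m)) (j j' : Fin (8 * m)) → j ≢ j' → GEdge n m (uu i j) (ww i j')

GAdj : (n m : ℕ) → GV n m → GV n m → Set
GAdj n m x y = GEdge n m x y ⊎ GEdge n m y x

-- Every edge xy of G n m has no common neighbour, so G n m is triangle-free, and
-- then it trivially contains neither K4 nor a diamond.  For neighbourhoods, each
-- vertex a has two neighbours x, y whose only common neighbour is a itself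
-- (v₀: two distinct v_j; v_j: v₀ and u_{1,j}; u_{i,j}: v_j and w_{i,j'} with
-- j' ≠ j; symmetrically for w_{i,j}), so N(a) ⊆ N(b) forces b = a.
module Submission where

open import Defs
open import Data.Nat using (ℕ; suc; _+_; _≥_; _≤_; s≤s; z≤n; _*_)
open import Data.Nat.Properties using (≤-trans; *-monoʳ-≤)
open import Data.Fin using (Fin; zero; suc; punchIn)
open import Data.Fin.Properties using (punchInᵢ≢i)
open import Data.Product using (_×_; _,_; Σ; ∃)
open import Data.Sum using (inj₁; inj₂)
open import Data.Empty using (⊥; ⊥-elim)
open import Relation.Nullary using (¬_)
open import Relation.Binary.PropositionalEquality using (_≡_; _≢_; refl; sym; ≢-sym)

∃-≢ : ∀ {k} → 2 ≤ k → (j : Fin k) → ∃ λ j′ → j′ ≢ j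
∃-≢ (s≤s (s≤s z≤n)) j = punchIn j zero , punchInᵢ≢i j zero

∃₂-≢ : ∀ {k} → 2 ≤ k → Σ (Fin k) λ j → ∃ λ j′ → j ≢ j′
∃₂-≢ (s≤s (s≤s z≤n)) = zero , suc zero , λ ()

module _ {V : Set} (Adj : V → V → Set) where

  ¬K4-if-triangleFree : TriangleFree Adj → ¬ HasInducedK4 Adj
  ¬K4-if-triangleFree tf (a , b , c , _ , a≢b , a≢c , _ , b≢c , _ , _ , ab , ac , _ , bc , _) =
    tf (a , b , c , a≢b , a≢c , b≢c , ab , ac , bc)

  ¬Diamond-if-triangleFree : TriangleFree Adj → ¬ HasInducedDiamond Adj
  ¬Diamond-if-triangleFree tf (a , b , c , _ , a≢b , a≢c , _ , b≢c , _ , _ , ab , ac , _ , bc , _) =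
    tf (a , b , c , a≢b , a≢c , b≢c , ab , ac , bc)

  Pinned : V → Set
  Pinned a = Σ V λ x → Σ V λ y → Adj a x × Adj a y × (∀ b → Adj b x → Adj b y → b ≡ a)

  ¬NbhdSubset-if-pinned : ∀ {a} → Pinned a → ∀ b → a ≢ b → ¬ NbhdSubset Adj a b
  ¬NbhdSubset-if-pinned (x , y , ax , ay , only-a) b a≢b N[a]⊆N[b] =
    a≢b (sym (only-a b (N[a]⊆N[b] x ax) (N[a]⊆N[b] y ay)))

module _ {n m : ℕ} where

  private
    _~_ : GV n m → GV n m → Set
    _~_ = GAdj n m

  edge-noCommonNeighbour : ∀ {x y z} → GEdge n m x y → x ~ z → y ~ z → ⊥
  edge-noCommonNeighbour (e-v0 _) (inj₁ (e-v0 _)) (inj₁ ())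
  edge-noCommonNeighbour (e-v0 _) (inj₁ (e-v0 _)) (inj₂ ())
  edge-noCommonNeighbour (e-vu _ _) (inj₁ ()) (inj₂ (e-vu _ _))
  edge-noCommonNeighbour (e-vu _ _) (inj₂ ()) (inj₂ (e-vu _ _))
  edge-noCommonNeighbour (e-vu _ _) (inj₁ (e-vw _ _)) (inj₁ (e-uw _ _ _ j≢j)) = j≢j refl
  edge-noCommonNeighbour (e-vu _ _) (inj₂ ()) (inj₁ (e-uw _ _ _ _))
  edge-noCommonNeighbour (e-vw _ _) (inj₁ ()) (inj₂ (e-vw _ _))
  edge-noCommonNeighbour (e-vw _ _) (inj₂ ()) (inj₂ (e-vw _ _))
  edge-noCommonNeighbour (e-vw _ _) (inj₁ (e-vu _ _)) (inj₂ (e-uw _ _ _ j≢j)) = j≢j refl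
  edge-noCommonNeighbour (e-vw _ _) (inj₂ ()) (inj₂ (e-uw _ _ _ _))
  edge-noCommonNeighbour (e-uw _ _ _ j≢k) (inj₂ (e-vu _ _)) (inj₂ (e-vw _ _)) = j≢k refl
  edge-noCommonNeighbour (e-uw _ _ _ _) (inj₁ ()) (inj₂ (e-uw _ _ _ _))

  triangleFree : TriangleFree (GAdj n m)
  triangleFree (a , b , c , _ , _ , _ , inj₁ ab , ac , bc) = edge-noCommonNeighbour ab ac bc
  triangleFree (a , b , c , _ , _ , _ , inj₂ ba , ac , bc) = edge-noCommonNeighbour ba bc ac

  common-vⱼ-vₖ : ∀ {b j k} → j ≢ k → b ~ vtx (suc j) → b ~ vtx (suc k) → b ≡ vtx zero
  common-vⱼ-vₖ _   (inj₁ (e-v0 _))   _                 = refl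
  common-vⱼ-vₖ _   (inj₂ (e-vu _ _)) (inj₁ ())
  common-vⱼ-vₖ j≢j (inj₂ (e-vu _ _)) (inj₂ (e-vu _ _)) = ⊥-elim (j≢j refl)
  common-vⱼ-vₖ _   (inj₂ (e-vw _ _)) (inj₁ ())
  common-vⱼ-vₖ j≢j (inj₂ (e-vw _ _)) (inj₂ (e-vw _ _)) = ⊥-elim (j≢j refl)

  common-v₀-uᵢⱼ : ∀ {b i j} → b ~ vtx zero → b ~ uu i j → b ≡ vtx (suc j)
  common-v₀-uᵢⱼ (inj₁ ())
  common-v₀-uᵢⱼ (inj₂ (e-v0 _)) (inj₁ (e-vu _ _)) = refl
  common-v₀-uᵢⱼ (inj₂ (e-v0 _)) (inj₂ ())

  common-vⱼ-wᵢₖ : ∀ {b i j k} → b ~ vtx (suc j) → b ~ ww i k → b ≡ uu i j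
  common-vⱼ-wᵢₖ (inj₁ (e-v0 _))   (inj₁ ())
  common-vⱼ-wᵢₖ (inj₁ (e-v0 _))   (inj₂ ())
  common-vⱼ-wᵢₖ (inj₂ (e-vu _ _)) (inj₁ (e-uw _ _ _ _)) = refl
  common-vⱼ-wᵢₖ (inj₂ (e-vu _ _)) (inj₂ ())
  common-vⱼ-wᵢₖ (inj₂ (e-vw _ _)) (inj₁ ())
  common-vⱼ-wᵢₖ (inj₂ (e-vw _ _)) (inj₂ ())

  common-vⱼ-uᵢₖ : ∀ {b i j k} → b ~ vtx (suc j) → b ~ uu i k → b ≡ ww i j
  common-vⱼ-uᵢₖ (inj₁ (e-v0 _))   (inj₁ ())
  common-vⱼ-uᵢₖ (inj₁ (e-v0 _))   (inj₂ ())
  common-vⱼ-uᵢₖ (inj₂ (e-vu _ _)) (inj₁ ())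
  common-vⱼ-uᵢₖ (inj₂ (e-vu _ _)) (inj₂ ())
  common-vⱼ-uᵢₖ (inj₂ (e-vw _ _)) (inj₁ ())
  common-vⱼ-uᵢₖ (inj₂ (e-vw _ _)) (inj₂ (e-uw _ _ _ _)) = refl

  pinned : Fin (n + 5 * m) → 2 ≤ 8 * m → ∀ a → Pinned (GAdj n m) a
  pinned _ 2≤8m (vtx zero) =
    let j , k , j≢k = ∃₂-≢ 2≤8m in
    vtx (suc j) , vtx (suc k) , inj₁ (e-v0 j) , inj₁ (e-v0 k) , λ _ → common-vⱼ-vₖ j≢k
  pinned i₀ _ (vtx (suc j)) =
    vtx zero , uu i₀ j , inj₂ (e-v0 j) , inj₁ (e-vu i₀ j) , λ _ → common-v₀-uᵢⱼ
  pinned _ 2≤8m (uu i j) =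
    let k , k≢j = ∃-≢ 2≤8m j in
    vtx (suc j) , ww i k , inj₂ (e-vu i j) , inj₁ (e-uw i j k (≢-sym k≢j)) , λ _ → common-vⱼ-wᵢₖ
  pinned _ 2≤8m (ww i j) =
    let k , k≢j = ∃-≢ 2≤8m j in
    vtx (suc j) , uu i k , inj₂ (e-vw i j) , inj₂ (e-uw i k j k≢j) , λ _ → common-vⱼ-uᵢₖ

lemma3 : (n m : ℕ) → n ≥ 1 → m ≥ 1 → Irreducible (GAdj n m) × TriangleFree (GAdj n m)
lemma3 (suc n) m _ m≥1 =
  ( ¬K4-if-triangleFree (GAdj (suc n) m) triangleFree
  , ¬Diamond-if-triangleFree (GAdj (suc n) m) triangleFree
  , λ a → ¬NbhdSubset-if-pinned (GAdj (suc n) m) (pinned zero 2≤8m a) )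
  , triangleFree
  where
  2≤8m : 2 ≤ 8 * m
  2≤8m = ≤-trans (s≤s (s≤s z≤n)) (*-monoʳ-≤ 8 m≥1)
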